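{- Let $n\ge 1$ and let $[K_n,P]$ be a decomposition of the complete graph $K_n$, i.e. $P$ is a set of induced (hence complete) subgraphs of $K_n$ such that every edge of $K_n$ belongs to exactly one member of $P$. Let $\overrightarrow{K}_n$ be the symmetric complete digraph on $V(K_n)$ without loops, and regard each $p\in P$ as the symmetric complete subdigraph of $\overrightarrow{K}_n$ on $V(p)$ (containing both arcs $(u,v)$ and $(v,u)$ for every edge $uv$ of $p$); this gives the induced decomposition $[\overrightarrow{K}_n,P]$ of the arcs of $\overrightarrow{K}_n$. Let $L$ be the set of the $n$ loops at the vertices of $K_n$, let $\overrightarrow{K}_n^*$ be $\overrightarrow{K}_n$ together with $L$, and for $p\in P$ let $p^*$ denote $p$ together with the loops at its vertices. Let $\mathcal{F}$ be a linear-factorization of $\overrightarrow{K}_n^*$. Suppose there exists a function $h\colon P\to\mathcal{F}$ such that for every $p\in P$, the arc set $(A(p)\cup L)\cap A(h(p))$ is the arc set of a linear-factor $F_p$ of $p^*$, and for any distinct $p,q\in P$, $A(F_p)\cap A(F_q)=\emptyset$. Then $\chi'([K_n,P])\le n$.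
   Context: A digraph has a finite nonempty vertex set and a set $A$ of ordered pairs (arcs); a loop is an arc $(v,v)$. A $d$-gon ($d\ge 2$) is a directed cycle with vertices $v_1,\dots,v_d$ and arcs $(v_i,v_{i+1})$ ($1\le i<d$) and $(v_d,v_1)$; a loop is a $1$-gon. The complete digraph $\overrightarrow{K}_m^*$ on $m$ vertices has all $m^2$ ordered pairs as arcs (the $m$ loops and both arcs between every pair of distinct vertices). A linear-factor of a complete digraph with loops on $m$ vertices is a subdigraph with all $m$ vertices and exactly $m$ arcs that is a union of pairwise vertex-disjoint $d$-gons ($d\ge1$). A linear-factorization of $\overrightarrow{K}_n^*$ is a set of pairwise arc-disjoint linear-factors whose arc sets partition the arcs of $\overrightarrow{K}_n^*$. For a decomposition $[G,P]$ of a simple graph $G$, a $k$-$P$-coloring is a surjective map from $E(G)$ to a $k$-set of colors such that all edges of each $H\in P$ receive the same color, and whenever $H_1\neq H_2\in P$ share a vertex, $E(H_1)$ and $E(H_2)$ receive different colors. The chromatic index $\chi'([G,P])$ is the smallest $k$ for which a $k$-$P$-coloring exists. -}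

module Defs where

open import Data.Nat using (ℕ; _≤_)
open import Data.Fin using (Fin)
open import Data.Fin.Subset using (Subset; _∈_; ⊤)
open import Data.Bool using (Bool; true)
open import Data.Product using (Σ; ∃; ∃-syntax; _×_; _,_)
open import Data.Sum using (_⊎_)
open import Relation.Binary.PropositionalEquality using (_≡_; _≢_)

-- A vertex is an element of Fin n.  A (simple) arc set on Fin n is a
-- Bool-valued relation: A u v ≡ true  means  (u , v) is an arc.
Arcs : ℕ → Set
Arcs n = Fin n → Fin n → Bool

ExactlyOne : ∀ {m} → (Fin m → Set) → Set
ExactlyOne {m} Q = Σ (Fin m) Q × (∀ i j → Q i → Q j → i ≡ j)

-- Decomposition [K_n , P]: the members of P are induced (complete) subgraphs
-- of K_n, given by their vertex sets P i (i : Fin m).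
IsDecomposition : ∀ {n m} → (Fin m → Subset n) → Set
IsDecomposition {n} {m} P =
  (∀ i → ∃[ u ] ∃[ v ] (u ≢ v × u ∈ P i × v ∈ P i)) ×
  (∀ (u v : Fin n) → u ≢ v → ExactlyOne (λ i → u ∈ P i × v ∈ P i))

-- A is the arc set of a linear-factor of the complete digraph with loops on
-- the vertex set S: all arcs lie inside S, and every vertex of S has exactly
-- one outgoing and exactly one incoming arc (i.e. the arcs form a spanning
-- union of vertex-disjoint d-gons, d ≥ 1, loops being 1-gons).
IsLinearFactorOn : ∀ {n} → Subset n → Arcs n → Set
IsLinearFactorOn {n} S A =
  (∀ u v → A u v ≡ true → u ∈ S × v ∈ S) ×
  (∀ u → u ∈ S →
      (Σ (Fin n) λ w → A u w ≡ true × (∀ w' → A u w' ≡ true → w' ≡ w)) ×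
      (Σ (Fin n) λ w → A w u ≡ true × (∀ w' → A w' u ≡ true → w' ≡ w)))

IsLinearFactorization : ∀ {n k} → (Fin k → Arcs n) → Set
IsLinearFactorization {n} {k} F =
  (∀ j → IsLinearFactorOn ⊤ (F j)) ×
  (∀ (u v : Fin n) → ExactlyOne (λ j → F j u v ≡ true))

-- Arc set (A(p) ∪ L) ∩ A(f) for a member p with vertex set S and a factor f:
-- A(p) = arcs (u,v), u ≢ v, u,v ∈ S (symmetric complete digraph on S);
-- L = loops at all n vertices.
MemberArcsMeet : ∀ {n} → Subset n → Arcs n → Fin n → Fin n → Set
MemberArcsMeet S f u v = ((u ≡ v) ⊎ (u ≢ v × u ∈ S × v ∈ S)) × f u v ≡ true

EdgeColouring : ℕ → ℕ → Set
EdgeColouring n k = (u v : Fin n) → u ≢ v → Fin k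

IsPColouring : ∀ {n m k} → (Fin m → Subset n) → EdgeColouring n k → Set
IsPColouring {n} {m} {k} P c =
  (∀ u v (p : u ≢ v) (q : v ≢ u) → c u v p ≡ c v u q) ×
  (∀ (col : Fin k) → ∃[ u ] ∃[ v ] Σ (u ≢ v) λ p → c u v p ≡ col) ×
  (∀ i u v u' v' (p : u ≢ v) (p' : u' ≢ v') →
      u ∈ P i → v ∈ P i → u' ∈ P i → v' ∈ P i → c u v p ≡ c u' v' p') ×
  (∀ i j → i ≢ j → ∀ w → w ∈ P i → w ∈ P j →
      ∀ u v u' v' (p : u ≢ v) (p' : u' ≢ v') →
      u ∈ P i → v ∈ P i → u' ∈ P j → v' ∈ P j → c u v p ≢ c u' v' p')

ChromaticIndexAtMost : ∀ {n m} → (Fin m → Subset n) → ℕ → Set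
ChromaticIndexAtMost {n} P N =
  ∃[ k ] (k ≤ N × Σ (EdgeColouring n k) (IsPColouring P))

{-# OPTIONS --safe #-}
module Submission where

-- Colour every edge uv of K_n by the factor h(p) of the member p containing
-- it, keeping only the factors actually used.  Two members p ≠ q through a
-- common vertex w get different factors: otherwise the out-arcs of w in F_p
-- and F_q both lie in the one factor h(p) = h(q), hence coincide, and F_p,
-- F_q share an arc.  The number of colours is at most the number of factors,
-- which is at most n because the factors have pairwise distinct out-arcs at
-- any fixed vertex.

open import Defs
open import Data.Nat using (ℕ; zero; suc; _≤_)
open import Data.Nat.Properties using (≤-trans)
open import Data.Fin using (Fin; zero; suc; fromℕ<)
open import Data.Fin.Subset using (Subset; _∈_; ⊤)
open import Data.Fin.Subset.Properties using (∈⊤)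
open import Data.Fin.Properties using (any?; injective⇒≤; _≟_)
open import Data.Bool using (true)
open import Data.Empty using (⊥)
open import Data.Product using (Σ; ∃; _×_; _,_; proj₁; proj₂)
open import Function using (_∘_)
open import Function.Definitions using (Injective)
open import Relation.Nullary using (¬_; yes; no; contradiction)
open import Relation.Binary.PropositionalEquality using (_≡_; _≢_; refl; sym; trans; cong; subst)

private
  variable
    n m k : ℕ

record ImageFactorisation (h : Fin m → Fin k) : Set where
  field
    size            : ℕ
    onto            : Fin m → Fin size
    into            : Fin size → Fin k
    into∘onto       : ∀ i → into (onto i) ≡ h i
    into-injective  : Injective _≡_ _≡_ into
    onto-surjective : ∀ c → ∃ λ i → onto i ≡ c

module _ {h : Fin (suc m) → Fin k} (I : ImageFactorisation (h ∘ suc)) where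
  open ImageFactorisation I

  extendByOldValue : ∃ (λ c → into c ≡ h zero) → ImageFactorisation h
  extendByOldValue (c , into-c) = record
    { size            = size
    ; onto            = onto′
    ; into            = into
    ; into∘onto       = into∘onto′
    ; into-injective  = into-injective
    ; onto-surjective = λ d → let i , onto-i = onto-surjective d in suc i , onto-i
    }
    where
    onto′ : Fin (suc m) → Fin size
    onto′ zero    = c
    onto′ (suc i) = onto i

    into∘onto′ : ∀ i → into (onto′ i) ≡ h i
    into∘onto′ zero    = into-c
    into∘onto′ (suc i) = into∘onto i

  extendByNewValue : ¬ ∃ (λ c → into c ≡ h zero) → ImageFactorisation h
  extendByNewValue new = record
    { size            = suc size
    ; onto            = onto′
    ; into            = into′
    ; into∘onto       = into∘onto′
    ; into-injective  = into′-injective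
    ; onto-surjective = onto′-surjective
    }
    where
    onto′ : Fin (suc m) → Fin (suc size)
    onto′ zero    = zero
    onto′ (suc i) = suc (onto i)

    into′ : Fin (suc size) → Fin k
    into′ zero    = h zero
    into′ (suc c) = into c

    into∘onto′ : ∀ i → into′ (onto′ i) ≡ h i
    into∘onto′ zero    = refl
    into∘onto′ (suc i) = into∘onto i

    into′-injective : Injective _≡_ _≡_ into′
    into′-injective {zero}  {zero}  _ = refl
    into′-injective {zero}  {suc d} p = contradiction (d , sym p) new
    into′-injective {suc c} {zero}  p = contradiction (c , p) new
    into′-injective {suc c} {suc d} p = cong suc (into-injective p)

    onto′-surjective : ∀ c → ∃ λ i → onto′ i ≡ c
    onto′-surjective zero    = zero , refl
    onto′-surjective (suc c) = let i , onto-i = onto-surjective c in suc i , cong suc onto-i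

imageFactorisation : (h : Fin m → Fin k) → ImageFactorisation h
imageFactorisation {zero} h = record
  { size            = 0
  ; onto            = λ ()
  ; into            = λ ()
  ; into∘onto       = λ ()
  ; into-injective  = λ { {()} }
  ; onto-surjective = λ ()
  }
imageFactorisation {suc m} h
  with I ← imageFactorisation (h ∘ suc)
  with any? (λ c → ImageFactorisation.into I c ≟ h zero)
... | yes old = extendByOldValue I old
... | no  new = extendByNewValue I new

_⊆ₐ_ : Arcs n → Arcs n → Set
A ⊆ₐ B = ∀ {u v} → A u v ≡ true → B u v ≡ true

module _ {S : Subset n} {A : Arcs n} (factor : IsLinearFactorOn S A) {u : Fin n} (u∈S : u ∈ S) where

  successor : Fin n
  successor = proj₁ (proj₁ (proj₂ factor u u∈S))

  successor-arc : A u successor ≡ true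
  successor-arc = proj₁ (proj₂ (proj₁ (proj₂ factor u u∈S)))

  successor-unique : ∀ {w} → A u w ≡ true → w ≡ successor
  successor-unique = proj₂ (proj₂ (proj₁ (proj₂ factor u u∈S))) _

subfactors-sharedVertex⇒sharedArc :
  ∀ {F A B : Arcs n} {S T : Subset n} →
  IsLinearFactorOn ⊤ F → IsLinearFactorOn S A → IsLinearFactorOn T B →
  A ⊆ₐ F → B ⊆ₐ F → ∀ {w} → w ∈ S → w ∈ T →
  ∃ λ x → A w x ≡ true × B w x ≡ true
subfactors-sharedVertex⇒sharedArc {A = A} F-factor A-factor B-factor A⊆F B⊆F {w} w∈S w∈T =
  successor B-factor w∈T , subst (λ x → A w x ≡ true) A-succ≡B-succ (successor-arc A-factor w∈S)
                         , successor-arc B-factor w∈T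
  where
  A-succ≡B-succ : successor A-factor w∈S ≡ successor B-factor w∈T
  A-succ≡B-succ = trans (successor-unique F-factor ∈⊤ (A⊆F (successor-arc A-factor w∈S)))
                   (sym (successor-unique F-factor ∈⊤ (B⊆F (successor-arc B-factor w∈T))))

linearFactorization-size≤ : ∀ {ℱ : Fin k → Arcs n} →
  IsLinearFactorization ℱ → Fin n → k ≤ n
linearFactorization-size≤ {k = k} {n = n} {ℱ = ℱ} (factors , exactlyOne) v =
  injective⇒≤ successor-injective
  where
  successorOf : Fin k → Fin n
  successorOf j = successor (factors j) (∈⊤ {x = v})

  successor-injective : Injective _≡_ _≡_ successorOf
  successor-injective {i} {j} same = proj₂ (exactlyOne v (successorOf j)) i j
    (subst (λ x → ℱ i v x ≡ true) same (successor-arc (factors i) ∈⊤))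
    (successor-arc (factors j) ∈⊤)

module _ {P : Fin m → Subset n} (decomposition : IsDecomposition P) where

  memberOf : ∀ {u v} → u ≢ v → Fin m
  memberOf u≢v = proj₁ (proj₁ (proj₂ decomposition _ _ u≢v))

  memberOf-contains : ∀ {u v} (u≢v : u ≢ v) → u ∈ P (memberOf u≢v) × v ∈ P (memberOf u≢v)
  memberOf-contains u≢v = proj₂ (proj₁ (proj₂ decomposition _ _ u≢v))

  memberOf-unique : ∀ {u v i} (u≢v : u ≢ v) → u ∈ P i → v ∈ P i → memberOf u≢v ≡ i
  memberOf-unique u≢v u∈Pi v∈Pi =
    proj₂ (proj₂ decomposition _ _ u≢v) _ _ (memberOf-contains u≢v) (u∈Pi , v∈Pi)

  colourMembers : (Fin m → Fin k) → EdgeColouring n k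
  colourMembers g u v u≢v = g (memberOf u≢v)

  colourMembers-isPColouring :
    (g : Fin m → Fin k) → (∀ c → ∃ λ i → g i ≡ c) →
    (∀ i j → i ≢ j → ∀ {w} → w ∈ P i → w ∈ P j → g i ≢ g j) →
    IsPColouring P (colourMembers g)
  colourMembers-isPColouring g g-surjective g-proper =
    symmetric , surjective , constant , proper
    where
    colour≡ : ∀ {u v i} (u≢v : u ≢ v) → u ∈ P i → v ∈ P i → colourMembers g u v u≢v ≡ g i
    colour≡ u≢v u∈Pi v∈Pi = cong g (memberOf-unique u≢v u∈Pi v∈Pi)

    symmetric : ∀ u v (u≢v : u ≢ v) (v≢u : v ≢ u) →
      colourMembers g u v u≢v ≡ colourMembers g v u v≢u
    symmetric u v u≢v v≢u =
      sym (colour≡ v≢u (proj₂ (memberOf-contains u≢v)) (proj₁ (memberOf-contains u≢v)))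

    surjective : ∀ c → ∃ λ u → ∃ λ v → Σ (u ≢ v) λ u≢v → colourMembers g u v u≢v ≡ c
    surjective c with i , gi≡c ← g-surjective c
                 with u , v , u≢v , u∈Pi , v∈Pi ← proj₁ decomposition i =
      u , v , u≢v , trans (colour≡ u≢v u∈Pi v∈Pi) gi≡c

    constant : ∀ i u v u′ v′ (u≢v : u ≢ v) (u′≢v′ : u′ ≢ v′) →
      u ∈ P i → v ∈ P i → u′ ∈ P i → v′ ∈ P i →
      colourMembers g u v u≢v ≡ colourMembers g u′ v′ u′≢v′
    constant i u v u′ v′ u≢v u′≢v′ u∈Pi v∈Pi u′∈Pi v′∈Pi =
      trans (colour≡ u≢v u∈Pi v∈Pi) (sym (colour≡ u′≢v′ u′∈Pi v′∈Pi))

    proper : ∀ i j → i ≢ j → ∀ w → w ∈ P i → w ∈ P j →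
      ∀ u v u′ v′ (u≢v : u ≢ v) (u′≢v′ : u′ ≢ v′) →
      u ∈ P i → v ∈ P i → u′ ∈ P j → v′ ∈ P j →
      colourMembers g u v u≢v ≢ colourMembers g u′ v′ u′≢v′
    proper i j i≢j w w∈Pi w∈Pj u v u′ v′ u≢v u′≢v′ u∈Pi v∈Pi u′∈Pj v′∈Pj same =
      g-proper i j i≢j w∈Pi w∈Pj
        (trans (sym (colour≡ u≢v u∈Pi v∈Pi)) (trans same (colour≡ u′≢v′ u′∈Pj v′∈Pj)))

theorem1 : (n : ℕ) → 1 ≤ n →
    (m : ℕ) (P : Fin m → Subset n) → IsDecomposition P →
    (k : ℕ) (ℱ : Fin k → Arcs n) → IsLinearFactorization ℱ →
    (h : Fin m → Fin k) →
    (Σ (Fin m → Arcs n) λ Fp →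
      (∀ i → IsLinearFactorOn (P i) (Fp i)) ×
      (∀ i u v → (Fp i u v ≡ true → MemberArcsMeet (P i) (ℱ (h i)) u v) ×
                 (MemberArcsMeet (P i) (ℱ (h i)) u v → Fp i u v ≡ true)) ×
      (∀ i j → i ≢ j → ∀ u v → Fp i u v ≡ true → Fp j u v ≡ true → ⊥)) →
    ChromaticIndexAtMost P n
theorem1 n 1≤n m P decomposition k ℱ factorization h (Fp , Fp-factor , Fp-meet , Fp-disjoint) =
  size
  , ≤-trans (injective⇒≤ into-injective) (linearFactorization-size≤ factorization (fromℕ< 1≤n))
  , colourMembers decomposition onto
  , colourMembers-isPColouring decomposition onto onto-surjective onto-proper
  where
  open ImageFactorisation (imageFactorisation h)

  Fp⊆ℱ : ∀ i → Fp i ⊆ₐ ℱ (h i)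
  Fp⊆ℱ i arc = proj₂ (proj₁ (Fp-meet i _ _) arc)

  h-proper : ∀ i j → i ≢ j → ∀ {w} → w ∈ P i → w ∈ P j → h i ≢ h j
  h-proper i j i≢j w∈Pi w∈Pj hi≡hj
    with x , arc-i , arc-j ← subfactors-sharedVertex⇒sharedArc (proj₁ factorization (h i))
           (Fp-factor i) (Fp-factor j) (Fp⊆ℱ i) (subst (λ c → Fp j ⊆ₐ ℱ c) (sym hi≡hj) (Fp⊆ℱ j))
           w∈Pi w∈Pj
    = Fp-disjoint i j i≢j _ x arc-i arc-j

  onto-proper : ∀ i j → i ≢ j → ∀ {w} → w ∈ P i → w ∈ P j → onto i ≢ onto j
  onto-proper i j i≢j w∈Pi w∈Pj same =
    h-proper i j i≢j w∈Pi w∈Pj (trans (sym (into∘onto i)) (trans (cong into same) (into∘onto j)))
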